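{- Let $\mathfrak{M}$ and $\mathfrak{M}'$ be two L$_1$-models. (1) The collection of L$_1$-simulations from $\mathfrak{M}$ to $\mathfrak{M}'$, ordered by inclusion, forms a complete lattice. (2) The relation of L$_1$-similarity between $\mathfrak{M}$ and $\mathfrak{M}'$ (the set of pairs $(w,w')$ such that some L$_1$-simulation from $\mathfrak{M}$ to $\mathfrak{M}'$ contains $(w,w')$) is itself an L$_1$-simulation.
   Context: A meet-semilattice $(W,1,\curlywedge)$ is a poset in which every finite subset has a meet; $\curlywedge$ is binary meet, $1$ the top, $w\preccurlyeq v$ iff $w\curlywedge v=w$. A filter is a $\preccurlyeq$-upward closed subset closed under finite meets. An L$_1$-model $(W,1,\curlywedge,V)$ is a meet-semilattice with a valuation $V$ assigning a filter $V(p)$ to each proposition letter $p$ in a fixed set $\mathrm{Prop}$. For L$_1$-models $\mathfrak{M}=(W,1,\curlywedge,V)$ and $\mathfrak{M}'=(W',1',\curlywedge',V')$, an L$_1$-simulation from $\mathfrak{M}$ to $\mathfrak{M}'$ is a relation $S\subseteq W\times W'$ such that for all $(w,w')\in S$: (S1) if $w\in V(p)$ then $w'\in V'(p)$, for all $p\in\mathrm{Prop}$; (S2) if $w=1$ then $w'=1'$; (S3) if $v,u\in W$ satisfy $v\curlywedge u\preccurlyeq w$, then there exist $v',u'\in W'$ with $(v,v')\in S$, $(u,u')\in S$ and $v'\curlywedge' u'\preccurlyeq' w'$. -}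

module Defs where

open import Level using (Level; _⊔_; suc)
open import Data.Product using (Σ; ∃; _×_; _,_)
open import Relation.Binary.Core using (REL)
open import Relation.Binary.Lattice.Bundles using (BoundedMeetSemilattice)

record IsFilter {c ℓ₁ ℓ₂ f} (L : BoundedMeetSemilattice c ℓ₁ ℓ₂)
                (F : BoundedMeetSemilattice.Carrier L → Set f) : Set (c ⊔ ℓ₂ ⊔ f) where
  open BoundedMeetSemilattice L
  field
    upward : ∀ {w v} → w ≤ v → F w → F v
    top    : F ⊤
    meet   : ∀ {w v} → F w → F v → F (w ∧ v)

record L1Model {p} (Prop : Set p) c ℓ₁ ℓ₂ f : Set (p ⊔ suc (c ⊔ ℓ₁ ⊔ ℓ₂ ⊔ f)) where
  field
    frame    : BoundedMeetSemilattice c ℓ₁ ℓ₂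
  open BoundedMeetSemilattice frame public
  field
    V        : Prop → Carrier → Set f
    V-filter : ∀ q → IsFilter frame (V q)

record IsL1Simulation {p c ℓ₁ ℓ₂ f c' ℓ₁' ℓ₂' f' r} {Prop : Set p}
    (M : L1Model Prop c ℓ₁ ℓ₂ f) (M' : L1Model Prop c' ℓ₁' ℓ₂' f')
    (S : REL (L1Model.Carrier M) (L1Model.Carrier M') r)
    : Set (p ⊔ c ⊔ ℓ₁ ⊔ ℓ₂ ⊔ f ⊔ c' ⊔ ℓ₁' ⊔ ℓ₂' ⊔ f' ⊔ r) where
  private
    module M  = L1Model M
    module M' = L1Model M'
  field
    S1 : ∀ {w w'} → S w w' → ∀ q → M.V q w → M'.V q w'
    S2 : ∀ {w w'} → S w w' → w M.≈ M.⊤ → w' M'.≈ M'.⊤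
    S3 : ∀ {w w'} → S w w' → ∀ v u → (v M.∧ u) M.≤ w →
         Σ M'.Carrier λ v' → Σ M'.Carrier λ u' →
           S v v' × S u u' × (v' M'.∧ u') M'.≤ w'

_⊆ᵣ_ : ∀ {a b r s} {A : Set a} {B : Set b} → REL A B r → REL A B s → Set (a ⊔ b ⊔ r ⊔ s)
R ⊆ᵣ S = ∀ {x y} → R x y → S x y

L1Similarity : ∀ {p c ℓ₁ ℓ₂ f c' ℓ₁' ℓ₂' f'} (r : Level) {Prop : Set p}
    (M : L1Model Prop c ℓ₁ ℓ₂ f) (M' : L1Model Prop c' ℓ₁' ℓ₂' f') →
    REL (L1Model.Carrier M) (L1Model.Carrier M')
        (p ⊔ c ⊔ ℓ₁ ⊔ ℓ₂ ⊔ f ⊔ c' ⊔ ℓ₁' ⊔ ℓ₂' ⊔ f' ⊔ suc r)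
L1Similarity r M M' w w' =
  Σ (REL (L1Model.Carrier M) (L1Model.Carrier M') r) λ S →
    IsL1Simulation M M' S × S w w'

-- Clauses (S1) and (S2) concern one pair at a time and (S3) only asks for
-- witnesses related by the simulation, so a relation T in which every pair
-- lies in some simulation R ⊆ T is itself a simulation.  The join of a family
-- of simulations is their union, its meet the union of all simulations below
-- every member, and similarity the union of all simulations.
module Submission where

open import Defs
open import Level using (Level; _⊔_; suc)
open import Data.Product using (Σ; _×_; _,_)
open import Relation.Binary.Core using (REL)

module _ {p c ℓ₁ ℓ₂ f c' ℓ₁' ℓ₂' f'} {Prop : Set p}
         (M : L1Model Prop c ℓ₁ ℓ₂ f) (M' : L1Model Prop c' ℓ₁' ℓ₂' f') where

  private
    Rel : (r : Level) → Set _
    Rel r = REL (L1Model.Carrier M) (L1Model.Carrier M') r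

  CoveredBySimulations : ∀ {t} (r : Level) → Rel t → Set _
  CoveredBySimulations r T =
    ∀ {w w'} → T w w' → Σ (Rel r) λ R → IsL1Simulation M M' R × R ⊆ᵣ T × R w w'

  covered⇒isL1Simulation : ∀ {t} r (T : Rel t) →
    CoveredBySimulations r T → IsL1Simulation M M' T
  covered⇒isL1Simulation r T cover = simT
    where
    open IsL1Simulation
    simT : IsL1Simulation M M' T
    S1 simT x with cover x
    ... | _ , sim , _ , Rww' = S1 sim Rww'
    S2 simT x with cover x
    ... | _ , sim , _ , Rww' = S2 sim Rww'
    S3 simT x v u vu≤w with cover x
    ... | _ , sim , R⊆T , Rww' with S3 sim Rww' v u vu≤w
    ...   | v' , u' , Rvv' , Ruu' , v'u'≤w' = v' , u' , R⊆T Rvv' , R⊆T Ruu' , v'u'≤w'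

  module _ {r} (I : Set r) (S : I → Rel r) where

    ⋃ : Rel r
    ⋃ w w' = Σ I λ i → S i w w'

    ⋃-upper : ∀ i → S i ⊆ᵣ ⋃
    ⋃-upper i x = i , x

    ⋃-isL1Simulation : (∀ i → IsL1Simulation M M' (S i)) → IsL1Simulation M M' ⋃
    ⋃-isL1Simulation simS =
      covered⇒isL1Simulation r ⋃ λ (i , x) → S i , simS i , ⋃-upper i , x

    ⋃-least : (R : Rel r) → (∀ i → S i ⊆ᵣ R) → ⋃ ⊆ᵣ R
    ⋃-least R S⊆R (i , x) = S⊆R i x

    LowerSimulation : Rel r → Set _
    LowerSimulation R = IsL1Simulation M M' R × (∀ i → R ⊆ᵣ S i)

    ⋂ : Rel (p ⊔ c ⊔ ℓ₁ ⊔ ℓ₂ ⊔ f ⊔ c' ⊔ ℓ₁' ⊔ ℓ₂' ⊔ f' ⊔ suc r)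
    ⋂ w w' = Σ (Rel r) λ R → LowerSimulation R × R w w'

    ⋂-lower : ∀ i → ⋂ ⊆ᵣ S i
    ⋂-lower i (_ , (_ , R⊆S) , x) = R⊆S i x

    ⋂-greatest : (R : Rel r) → IsL1Simulation M M' R → (∀ i → R ⊆ᵣ S i) → R ⊆ᵣ ⋂
    ⋂-greatest R sim R⊆S x = R , (sim , R⊆S) , x

    ⋂-isL1Simulation : IsL1Simulation M M' ⋂
    ⋂-isL1Simulation = covered⇒isL1Simulation r ⋂
      λ (R , (sim , R⊆S) , x) → R , sim , ⋂-greatest R sim R⊆S , x

  L1Similarity-isL1Simulation : ∀ r → IsL1Simulation M M' (L1Similarity r M M')
  L1Similarity-isL1Simulation r = covered⇒isL1Simulation r (L1Similarity r M M')
    λ (R , sim , x) → R , sim , (λ y → R , sim , y) , x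

proposition4p2 : ∀ {p c ℓ₁ ℓ₂ f c' ℓ₁' ℓ₂' f'} (r : Level) {Prop : Set p}
    (M : L1Model Prop c ℓ₁ ℓ₂ f) (M' : L1Model Prop c' ℓ₁' ℓ₂' f') →
    ((I : Set r) (S : I → REL (L1Model.Carrier M) (L1Model.Carrier M') r) →
      (∀ i → IsL1Simulation M M' (S i)) →
      (Σ (REL (L1Model.Carrier M) (L1Model.Carrier M') r) λ J →
        IsL1Simulation M M' J
        × (∀ i → S i ⊆ᵣ J)
        × (∀ (R : REL (L1Model.Carrier M) (L1Model.Carrier M') r) →
             IsL1Simulation M M' R → (∀ i → S i ⊆ᵣ R) → J ⊆ᵣ R))
      × (Σ (REL (L1Model.Carrier M) (L1Model.Carrier M')
                (p ⊔ c ⊔ ℓ₁ ⊔ ℓ₂ ⊔ f ⊔ c' ⊔ ℓ₁' ⊔ ℓ₂' ⊔ f' ⊔ suc r)) λ K →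
        IsL1Simulation M M' K
        × (∀ i → K ⊆ᵣ S i)
        × (∀ (R : REL (L1Model.Carrier M) (L1Model.Carrier M') r) →
             IsL1Simulation M M' R → (∀ i → R ⊆ᵣ S i) → R ⊆ᵣ K)))
    × IsL1Simulation M M' (L1Similarity r M M')
proposition4p2 r M M' =
    (λ I S simS →
        ( ⋃ M M' I S , ⋃-isL1Simulation M M' I S simS
        , ⋃-upper M M' I S , λ R _ → ⋃-least M M' I S R )
      , ( ⋂ M M' I S , ⋂-isL1Simulation M M' I S
        , ⋂-lower M M' I S , ⋂-greatest M M' I S ))
  , L1Similarity-isL1Simulation M M' r
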